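{- For integers $x\ge 0$ let $\Delta_3(x)=S_{3,0}(x)-S_{3,0}(4\lfloor x/4\rfloor)$. Then the sequence $\big((-1)^{s_2(x)}\Delta_3(x)\big)_{x\ge 0}$ is periodic with period $12$.
   Context: For an integer $b\ge 2$ and integer $r\ge 0$, $s_b(r)$ denotes the sum of the digits of $r$ in base $b$. For integers $x\ge 0$, define $$S_{3,0}(x)=\sum_{0\le r<x,\; r\equiv 0 \pmod 3}(-1)^{s_{2}(r)}.$$ -}

module Defs where

open import Data.Nat using (ℕ; zero; suc; _+_; _*_; _/_; _%_; _≟_)
open import Data.Integer using (ℤ; +_; -_) renaming (_+_ to _+ℤ_; _-_ to _-ℤ_; _*_ to _*ℤ_)
open import Relation.Nullary using (yes; no)

-- base-2 digit sum, computed with fuel (fuel ≥ r suffices, since r/2 < r)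
s₂-fuel : ℕ → ℕ → ℕ
s₂-fuel zero    r = 0
s₂-fuel (suc f) r = r % 2 + s₂-fuel f (r / 2)

s₂ : ℕ → ℕ
s₂ r = s₂-fuel r r

neg1^ : ℕ → ℤ
neg1^ zero    = + 1
neg1^ (suc k) = - neg1^ k

S₃₀ : ℕ → ℤ
S₃₀ zero    = + 0
S₃₀ (suc r) with r % 3 ≟ 0
... | yes _ = S₃₀ r +ℤ neg1^ (s₂ r)
... | no  _ = S₃₀ r

Δ₃ : ℕ → ℤ
Δ₃ x = S₃₀ x -ℤ S₃₀ (4 * (x / 4))

seq : ℕ → ℤ
seq x = neg1^ (s₂ x) *ℤ Δ₃ x

module Submission where

open import Defs
open import Data.Nat using (ℕ; _+_)
open import Relation.Binary.PropositionalEquality using (_≡_)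

open import Data.Nat using (zero; suc; _*_; _/_; _%_; _≤_; _<_; z≤n; s≤s; _≟_)
import Data.Nat.Properties as ℕₚ
import Data.Integer.Properties as ZP
open import Data.Nat.DivMod
open import Data.Nat.Divisibility using (divides-refl)
open import Data.Integer using (ℤ; +_; -_) renaming (_+_ to _+ℤ_; _-_ to _-ℤ_; _*_ to _*ℤ_)
open import Data.Nat.Tactic.RingSolver using () renaming (solve-∀ to solve-∀ℕ)
open import Data.Integer.Tactic.RingSolver using (solve-∀)
open import Relation.Nullary using (yes; no; ¬_)
open import Relation.Binary.PropositionalEquality using (refl; sym; trans; cong; cong₂; module ≡-Reasoning)
open import Data.Empty using (⊥-elim)

-- Write x = j + 4q with j < 4.  Since 4 is a power of 2, the binary digits
-- split: s₂ x = s₂ j + s₂ q, so (-1)^{s₂ x} = (-1)^{s₂ j} (-1)^{s₂ q}; and since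
-- 4 ≡ 1 (mod 3), x ≡ j + q (mod 3).  Hence the partial sum of S₃₀ inside the
-- block [4q, 4q + j) equals (-1)^{s₂ q} · B_{q mod 3}(j), where
--   B_c(j) = Σ_{i < j, i + c ≡ 0 mod 3} (-1)^{s₂ i}
-- depends only on j and c = q mod 3.  Thus Δ₃(x) = (-1)^{s₂ q} B_{q mod 3}(j),
-- and multiplying by (-1)^{s₂ x} the sign (-1)^{s₂ q} appears squared:
--   seq (j + 4q) = (-1)^{s₂ j} · B_{q mod 3}(j).
-- Replacing x by x + 12 replaces q by q + 3, which leaves j and q mod 3 fixed.
-- The file proves, in order: the recursion for the fuelled digit sum s₂ and
-- its behaviour on blocks of 4; the residue mod 3 and quotient by 4 of
-- j + 4q; the sign laws for neg1^; the one-step recursion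
-- of S₃₀ and its block formula; the closed form of seq; and finally lemma5.

s₂-fuel-zero : ∀ f → s₂-fuel f 0 ≡ 0
s₂-fuel-zero zero    = refl
s₂-fuel-zero (suc f) = s₂-fuel-zero f

half-≤ : ∀ r f → r ≤ suc f → r / 2 ≤ f
half-≤ zero    f _ = z≤n
half-≤ (suc r) f r≤1+f = ℕₚ.≤-pred (ℕₚ.<-≤-trans (m/n<m (suc r) 2 (s≤s (s≤s z≤n))) r≤1+f)

s₂-fuel-irrelevant : ∀ f g r → r ≤ f → r ≤ g → s₂-fuel f r ≡ s₂-fuel g r
s₂-fuel-irrelevant zero    g       .zero z≤n _   = sym (s₂-fuel-zero g)
s₂-fuel-irrelevant (suc f) zero    .zero _   z≤n = s₂-fuel-zero (suc f)
s₂-fuel-irrelevant (suc f) (suc g) r     r≤f r≤g =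
  cong (λ s → r % 2 + s) (s₂-fuel-irrelevant f g (r / 2) (half-≤ r f r≤f) (half-≤ r g r≤g))

s₂-unfold : ∀ r → s₂ r ≡ r % 2 + s₂ (r / 2)
s₂-unfold r = trans (s₂-fuel-irrelevant r (suc r) r ℕₚ.≤-refl (ℕₚ.n≤1+n r))
  (cong (λ s → r % 2 + s) (s₂-fuel-irrelevant r (r / 2) (r / 2) (m/n≤m r 2) ℕₚ.≤-refl))

s₂-append : ∀ b m → b < 2 → s₂ (b + m * 2) ≡ b + s₂ m
s₂-append b m b<2 = begin
  s₂ (b + m * 2)                    ≡⟨ s₂-unfold (b + m * 2) ⟩
  (b + m * 2) % 2 + s₂ ((b + m * 2) / 2)
    ≡⟨ cong₂ (λ d q → d + s₂ q) ([m+kn]%n≡m%n b m 2) (+-distrib-/-∣ʳ b (divides-refl m)) ⟩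
  b % 2 + s₂ (b / 2 + m * 2 / 2)
    ≡⟨ cong₂ (λ d q → d + s₂ (q + m * 2 / 2)) (m<n⇒m%n≡m b<2) (m<n⇒m/n≡0 b<2) ⟩
  b + s₂ (m * 2 / 2)                ≡⟨ cong (λ q → b + s₂ q) (m*n/n≡m m 2) ⟩
  b + s₂ m                          ∎
  where open ≡-Reasoning

s₂-block : ∀ j q → j < 4 → s₂ (j + q * 4) ≡ s₂ j + s₂ q
s₂-block j q j<4 = begin
  s₂ (j + q * 4)                      ≡⟨ cong s₂ split ⟩
  s₂ (j % 2 + (j / 2 + q * 2) * 2)    ≡⟨ s₂-append (j % 2) (j / 2 + q * 2) (m%n<n j 2) ⟩
  j % 2 + s₂ (j / 2 + q * 2)          ≡⟨ cong (λ s → j % 2 + s) (s₂-append (j / 2) q j/2<2) ⟩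
  j % 2 + (j / 2 + s₂ q)              ≡⟨ sym (ℕₚ.+-assoc (j % 2) (j / 2) (s₂ q)) ⟩
  j % 2 + j / 2 + s₂ q                ≡⟨ cong (_+ s₂ q) low-digits ⟩
  s₂ j + s₂ q                         ∎
  where
  open ≡-Reasoning
  j/2<2 : j / 2 < 2
  j/2<2 = m<n*o⇒m/o<n {n = 2} j<4
  split : j + q * 4 ≡ j % 2 + (j / 2 + q * 2) * 2
  split = trans (cong (_+ q * 4) (m≡m%n+[m/n]*n j 2)) (lemma (j % 2) (j / 2) q)
    where
    lemma : ∀ a b c → a + b * 2 + c * 4 ≡ a + (b + c * 2) * 2
    lemma = solve-∀ℕ
  low-digits : j % 2 + j / 2 ≡ s₂ j
  low-digits = sym (trans (s₂-unfold j) (cong (λ s → j % 2 + s) (s₂-small (j / 2) j/2<2)))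
    where
    s₂-small : ∀ d → d < 2 → s₂ d ≡ d
    s₂-small zero          _ = refl
    s₂-small (suc zero)    _ = refl
    s₂-small (suc (suc d)) (s≤s (s≤s ()))

-- Residues modulo 3: since 4 ≡ 1 (mod 3), (j + 4q) mod 3 only depends on j and q mod 3.
mod3-block : ∀ j q → (j + q * 4) % 3 ≡ (j + q % 3) % 3
mod3-block j q = begin
  (j + q * 4) % 3                    ≡⟨ cong (_% 3) (regroup j q) ⟩
  (j + q + q * 3) % 3                ≡⟨ [m+kn]%n≡m%n (j + q) q 3 ⟩
  (j + q) % 3                        ≡⟨ cong (λ t → (j + t) % 3) (m≡m%n+[m/n]*n q 3) ⟩
  (j + (q % 3 + q / 3 * 3)) % 3      ≡⟨ cong (_% 3) (sym (ℕₚ.+-assoc j (q % 3) (q / 3 * 3))) ⟩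
  (j + q % 3 + q / 3 * 3) % 3        ≡⟨ [m+kn]%n≡m%n (j + q % 3) (q / 3) 3 ⟩
  (j + q % 3) % 3                    ∎
  where
  open ≡-Reasoning
  regroup : ∀ a q → a + q * 4 ≡ a + q + q * 3
  regroup = solve-∀ℕ

div4-block : ∀ j q → j < 4 → (j + q * 4) / 4 ≡ q
div4-block j q j<4 = begin
  (j + q * 4) / 4     ≡⟨ +-distrib-/-∣ʳ j (divides-refl q) ⟩
  j / 4 + q * 4 / 4   ≡⟨ cong₂ _+_ (m<n⇒m/n≡0 j<4) (m*n/n≡m q 4) ⟩
  q                   ∎
  where open ≡-Reasoning

neg1^-+ : ∀ a b → neg1^ (a + b) ≡ neg1^ a *ℤ neg1^ b
neg1^-+ zero    b = sym (ZP.*-identityˡ (neg1^ b))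
neg1^-+ (suc a) b = trans (cong -_ (neg1^-+ a b)) (ZP.neg-distribˡ-* (neg1^ a) (neg1^ b))

-- Every sign squares to 1; this is what makes seq independent of (-1)^{s₂ q}.
neg1^-square : ∀ k → neg1^ k *ℤ neg1^ k ≡ + 1
neg1^-square zero    = refl
neg1^-square (suc k) = trans (neg-square (neg1^ k)) (neg1^-square k)
  where
  neg-square : ∀ a → (- a) *ℤ (- a) ≡ a *ℤ a
  neg-square = solve-∀

δ₀ : ℕ → ℤ
δ₀ zero    = + 1
δ₀ (suc _) = + 0

δ₀-nonzero : ∀ c → ¬ c ≡ 0 → δ₀ c ≡ + 0
δ₀-nonzero zero    c≢0 = ⊥-elim (c≢0 refl)
δ₀-nonzero (suc c) _   = refl

-- One step of S₃₀, with the membership test r ≡ 0 (mod 3) turned into a factor.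
S₃₀-suc : ∀ r → S₃₀ (suc r) ≡ S₃₀ r +ℤ δ₀ (r % 3) *ℤ neg1^ (s₂ r)
S₃₀-suc r with r % 3 ≟ 0
... | yes r%3≡0 = cong (S₃₀ r +ℤ_)
  (sym (trans (cong (λ c → δ₀ c *ℤ neg1^ (s₂ r)) r%3≡0) (ZP.*-identityˡ (neg1^ (s₂ r)))))
... | no  r%3≢0 = sym (begin
  S₃₀ r +ℤ δ₀ (r % 3) *ℤ neg1^ (s₂ r) ≡⟨ cong (λ d → S₃₀ r +ℤ d *ℤ neg1^ (s₂ r)) (δ₀-nonzero (r % 3) r%3≢0) ⟩
  S₃₀ r +ℤ + 0 *ℤ neg1^ (s₂ r)        ≡⟨ ZP.+-identityʳ (S₃₀ r) ⟩
  S₃₀ r                                ∎)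
  where open ≡-Reasoning

blockSum : ℕ → ℕ → ℤ
blockSum c zero    = + 0
blockSum c (suc j) = blockSum c j +ℤ δ₀ ((j + c) % 3) *ℤ neg1^ (s₂ j)

S₃₀-block : ∀ q j → j ≤ 4 →
            S₃₀ (j + q * 4) ≡ S₃₀ (q * 4) +ℤ neg1^ (s₂ q) *ℤ blockSum (q % 3) j
S₃₀-block q zero    _   = sym (trans (cong (S₃₀ (q * 4) +ℤ_) (ZP.*-zeroʳ (neg1^ (s₂ q))))
                                     (ZP.+-identityʳ (S₃₀ (q * 4))))
S₃₀-block q (suc j) j<4 = begin
  S₃₀ (suc (j + q * 4))
    ≡⟨ S₃₀-suc (j + q * 4) ⟩
  S₃₀ (j + q * 4) +ℤ δ₀ ((j + q * 4) % 3) *ℤ neg1^ (s₂ (j + q * 4))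
    ≡⟨ cong₂ (λ c s → S₃₀ (j + q * 4) +ℤ δ₀ c *ℤ s) (mod3-block j q)
             (trans (cong neg1^ (s₂-block j q j<4)) (neg1^-+ (s₂ j) (s₂ q))) ⟩
  S₃₀ (j + q * 4) +ℤ δ₀ ((j + q % 3) % 3) *ℤ (neg1^ (s₂ j) *ℤ neg1^ (s₂ q))
    ≡⟨ cong (_+ℤ δ₀ ((j + q % 3) % 3) *ℤ (neg1^ (s₂ j) *ℤ neg1^ (s₂ q)))
            (S₃₀-block q j (ℕₚ.<⇒≤ j<4)) ⟩
  (S₃₀ (q * 4) +ℤ neg1^ (s₂ q) *ℤ blockSum (q % 3) j)
    +ℤ δ₀ ((j + q % 3) % 3) *ℤ (neg1^ (s₂ j) *ℤ neg1^ (s₂ q))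
    ≡⟨ factor (S₃₀ (q * 4)) (neg1^ (s₂ q)) (blockSum (q % 3) j) (δ₀ ((j + q % 3) % 3)) (neg1^ (s₂ j)) ⟩
  S₃₀ (q * 4) +ℤ neg1^ (s₂ q) *ℤ blockSum (q % 3) (suc j) ∎
  where
  open ≡-Reasoning
  factor : ∀ s e b d n → (s +ℤ e *ℤ b) +ℤ d *ℤ (n *ℤ e) ≡ s +ℤ e *ℤ (b +ℤ d *ℤ n)
  factor = solve-∀

Δ₃-block : ∀ j q → j < 4 → Δ₃ (j + q * 4) ≡ neg1^ (s₂ q) *ℤ blockSum (q % 3) j
Δ₃-block j q j<4 = begin
  S₃₀ (j + q * 4) -ℤ S₃₀ (4 * ((j + q * 4) / 4))
    ≡⟨ cong (λ m → S₃₀ (j + q * 4) -ℤ S₃₀ (4 * m)) (div4-block j q j<4) ⟩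
  S₃₀ (j + q * 4) -ℤ S₃₀ (4 * q)
    ≡⟨ cong₂ (λ a m → a -ℤ S₃₀ m) (S₃₀-block q j (ℕₚ.<⇒≤ j<4)) (ℕₚ.*-comm 4 q) ⟩
  (S₃₀ (q * 4) +ℤ neg1^ (s₂ q) *ℤ blockSum (q % 3) j) -ℤ S₃₀ (q * 4)
    ≡⟨ cancel (S₃₀ (q * 4)) (neg1^ (s₂ q) *ℤ blockSum (q % 3) j) ⟩
  neg1^ (s₂ q) *ℤ blockSum (q % 3) j ∎
  where
  open ≡-Reasoning
  cancel : ∀ s d → (s +ℤ d) -ℤ s ≡ d
  cancel = solve-∀

-- Closed form of seq: the sign (-1)^{s₂ q} cancels against itself.
seq-block : ∀ j q → j < 4 → seq (j + q * 4) ≡ neg1^ (s₂ j) *ℤ blockSum (q % 3) j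
seq-block j q j<4 = begin
  neg1^ (s₂ (j + q * 4)) *ℤ Δ₃ (j + q * 4)
    ≡⟨ cong₂ _*ℤ_ (trans (cong neg1^ (s₂-block j q j<4)) (neg1^-+ (s₂ j) (s₂ q))) (Δ₃-block j q j<4) ⟩
  (n *ℤ e) *ℤ (e *ℤ b)   ≡⟨ regroup n e b ⟩
  n *ℤ (e *ℤ e) *ℤ b     ≡⟨ cong (λ s → n *ℤ s *ℤ b) (neg1^-square (s₂ q)) ⟩
  n *ℤ + 1 *ℤ b          ≡⟨ cong (_*ℤ b) (ZP.*-identityʳ n) ⟩
  n *ℤ b                 ∎
  where
  open ≡-Reasoning
  n = neg1^ (s₂ j)
  e = neg1^ (s₂ q)
  b = blockSum (q % 3) j
  regroup : ∀ n e b → (n *ℤ e) *ℤ (e *ℤ b) ≡ n *ℤ (e *ℤ e) *ℤ b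
  regroup = solve-∀

-- Periodicity: x + 12 lies in the block q + 3 at the same offset j, and q + 3 ≡ q (mod 3).
lemma5 : ∀ (x : ℕ) → seq (x + 12) ≡ seq x
lemma5 x = begin
  seq (x + 12)                       ≡⟨ cong seq shift ⟩
  seq (j + (q + 3) * 4)              ≡⟨ seq-block j (q + 3) j<4 ⟩
  neg1^ (s₂ j) *ℤ blockSum ((q + 3) % 3) j
                                     ≡⟨ cong (λ c → neg1^ (s₂ j) *ℤ blockSum c j) ([m+n]%n≡m%n q 3) ⟩
  neg1^ (s₂ j) *ℤ blockSum (q % 3) j ≡⟨ seq-block j q j<4 ⟨
  seq (j + q * 4)                    ≡⟨ cong seq (m≡m%n+[m/n]*n x 4) ⟨
  seq x                              ∎
  where
  open ≡-Reasoning
  j = x % 4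
  q = x / 4
  j<4 : j < 4
  j<4 = m%n<n x 4
  shift : x + 12 ≡ j + (q + 3) * 4
  shift = trans (cong (_+ 12) (m≡m%n+[m/n]*n x 4)) (regroup j q)
    where
    regroup : ∀ a b → a + b * 4 + 12 ≡ a + (b + 3) * 4
    regroup = solve-∀ℕ
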